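{- Let $X$ be a non-empty finite set, $k\ge1$, and $R$ a $k$-ary transit function on $X$. Then the Hasse diagram $\mathrm{Hasse}(\mathscr{C}_R)$ is a network if and only if there is $U\in X^{(k)}$ with $R(U)=X$.
   Context: $X^{(k)}$ is the set of non-empty subsets of $X$ of size at most $k$. A $k$-ary transit function on $X$ is a map $R:X^{(k)}\to 2^X$ with $U\subseteq R(U)$ for all $U\in X^{(k)}$ and $R(\{x\})=\{x\}$ for all $x\in X$. $\mathscr{C}_R=\{R(U)\mid U\in X^{(k)}\}$. For a set system $\mathscr{Q}\subseteq 2^X$, the Hasse diagram $\mathrm{Hasse}(\mathscr{Q})$ is the DAG with vertex set $\mathscr{Q}$ and a directed edge from $A$ to $B$ iff $B\subsetneq A$ and there is no $C\in\mathscr{Q}$ with $B\subsetneq C\subsetneq A$. A network is a DAG with exactly one vertex of indegree $0$. -}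

module Defs where

open import Data.Nat using (ℕ; _≤_)
open import Data.Fin using (Fin)
open import Data.Fin.Subset using (Subset; _⊆_; _⊂_; Nonempty; ∣_∣; ⁅_⁆)
open import Data.Product using (Σ; ∃; _×_)
open import Relation.Nullary using (¬_)
open import Relation.Binary.PropositionalEquality using (_≡_)
open import Relation.Binary.Construct.Closure.Transitive using (TransClosure)

-- The ground set X is Fin n.  X^(k): non-empty subsets of size at most k.
InXk : {n : ℕ} → ℕ → Subset n → Set
InXk k U = Nonempty U × ∣ U ∣ ≤ k

-- A k-ary transit function on Fin n.  R is given as a map on all subsets,
-- but only its values on X^(k) are constrained / used.
record IsTransit (n k : ℕ) (R : Subset n → Subset n) : Set where
  field
    extensive : ∀ U → InXk k U → U ⊆ R U
    singleton : ∀ (x : Fin n) → R ⁅ x ⁆ ≡ ⁅ x ⁆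

InC : {n : ℕ} → ℕ → (Subset n → Subset n) → Subset n → Set
InC k R A = ∃ λ U → InXk k U × R U ≡ A

HasseEdge : {n : ℕ} → (Subset n → Set) → Subset n → Subset n → Set
HasseEdge Q A B = Q A × Q B × B ⊂ A × (∀ C → Q C → ¬ (B ⊂ C × C ⊂ A))

IsNetwork : {n : ℕ} → (Subset n → Set) → (Subset n → Subset n → Set) → Set
IsNetwork Q E =
  (∀ A → Q A → ¬ TransClosure E A A)
  × (∃ λ A → Q A × (∀ B → Q B → ¬ E B A)
       × (∀ A' → Q A' → (∀ B → Q B → ¬ E B A') → A' ≡ A))

-- The sets of C_R are ordered by strict inclusion, and a Hasse edge
-- points from a set to a cover of it, so every vertex of the Hasse diagram
-- without an incoming edge is a maximal set of C_R (finiteness provides a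
-- cover of any non-maximal set), and conversely.  Hence the diagram, which
-- is always acyclic, is a network exactly when C_R has a unique maximal
-- set.  If X ∈ C_R it is that set.  Conversely, every singleton {x} =
-- R({x}) lies in C_R and below some maximal set, which must then be the
-- unique one; so the unique maximal set contains every x, i.e. it is X.
module Submission where

open import Defs
open import Data.Nat using (ℕ; _≤_; _<_; _∸_; _≤?_)
open import Data.Nat.Properties using (∸-monoʳ-<)
open import Data.Nat.Induction using (<-wellFounded)
open import Data.Bool.Properties using () renaming (_≟_ to _≟ᵇ_)
open import Data.Vec.Properties using (≡-dec)
open import Data.Fin using (Fin)
open import Data.Fin.Subset using (Subset; ⊤; _⊂_; _⊆_; _∈_; ∣_∣; ⁅_⁆)
open import Data.Fin.Subset.Properties
  using (⊂-trans; p⊂q⇒∣p∣<∣q∣; ∣p∣≤n; ∈⊤; ⊆⊤; ⊆-refl; ⊆-trans; ⊆-antisym;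
         _⊂?_; _∈?_; nonempty?; anySubset?; x∈⁅x⁆; ∣⁅x⁆∣≡1)
open import Data.Product using (∃; _×_; _,_; proj₁)
open import Function.Bundles using (_⇔_; mk⇔)
open import Induction.WellFounded using (WellFounded; Acc; acc)
open import Relation.Nullary using (¬_; yes; no; _×-dec_)
open import Relation.Nullary.Decidable using (decidable-stable)
open import Relation.Unary using (Decidable)
open import Relation.Binary.PropositionalEquality using (_≡_; sym; subst)
open import Relation.Binary.Construct.Closure.Transitive using (TransClosure; [_]; _∷_)

module _ {n : ℕ} where

  _⊃_ : Subset n → Subset n → Set
  A ⊃ B = B ⊂ A

  ⊂-wellFounded : WellFounded (_⊂_ {n})
  ⊂-wellFounded A = acc⊂ (<-wellFounded ∣ A ∣)
    where
    acc⊂ : ∀ {A} → Acc _<_ ∣ A ∣ → Acc (_⊂_ {n}) A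
    acc⊂ (acc rs) = acc λ B⊂A → acc⊂ (rs (p⊂q⇒∣p∣<∣q∣ B⊂A))

  ⊃-wellFounded : WellFounded _⊃_
  ⊃-wellFounded A = acc⊃ (<-wellFounded (n ∸ ∣ A ∣))
    where
    acc⊃ : ∀ {A} → Acc _<_ (n ∸ ∣ A ∣) → Acc _⊃_ A
    acc⊃ (acc rs) = acc λ {B} A⊂B → acc⊃ (rs (∸-monoʳ-< (p⊂q⇒∣p∣<∣q∣ A⊂B) (∣p∣≤n B)))

  ⊆∧⊄⇒≡ : ∀ {A B : Subset n} → A ⊆ B → ¬ (A ⊂ B) → A ≡ B
  ⊆∧⊄⇒≡ {A} A⊆B A⊄B = ⊆-antisym A⊆B λ {x} x∈B →
    decidable-stable (x ∈? A) λ x∉A → A⊄B (A⊆B , x , x∈B , x∉A)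

module _ {n : ℕ} (Q : Subset n → Set) where

  Maximal : Subset n → Set
  Maximal A = ∀ C → Q C → ¬ (A ⊂ C)

  Source : Subset n → Set
  Source A = ∀ B → Q B → ¬ HasseEdge Q B A

  HasseEdge⁺⇒⊃ : ∀ {A B} → TransClosure (HasseEdge Q) A B → A ⊃ B
  HasseEdge⁺⇒⊃ [ (_ , _ , B⊂A , _) ]     = B⊂A
  HasseEdge⁺⇒⊃ ((_ , _ , B⊂A , _) ∷ CB) = ⊂-trans (HasseEdge⁺⇒⊃ CB) B⊂A

  hasse-acyclic : ∀ A → ¬ TransClosure (HasseEdge Q) A A
  hasse-acyclic A AA with HasseEdge⁺⇒⊃ AA
  ... | (_ , x , x∈A , x∉A) = x∉A x∈A

  maximal⇒source : ∀ {A} → Maximal A → Source A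
  maximal⇒source maxA B qB (_ , _ , A⊂B , _) = maxA B qB A⊂B

  ⊤-maximal : Maximal ⊤
  ⊤-maximal _ _ (_ , _ , _ , x∉⊤) = x∉⊤ ∈⊤

  module _ (Q? : Decidable Q) where

    maximal-above : ∀ {D} → Q D → ∃ λ M → Q M × D ⊆ M × Maximal M
    maximal-above {D} = go (⊃-wellFounded D)
      where
      go : ∀ {D} → Acc _⊃_ D → Q D → ∃ λ M → Q M × D ⊆ M × Maximal M
      go {D} (acc rs) qD with anySubset? (λ C → Q? C ×-dec D ⊂? C)
      ... | no ∄C = D , qD , ⊆-refl , λ C qC D⊂C → ∄C (C , qC , D⊂C)
      ... | yes (C , qC , D⊂C) with go (rs D⊂C) qC
      ...   | M , qM , C⊆M , maxM = M , qM , ⊆-trans (proj₁ D⊂C) C⊆M , maxM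

    -- Descending from C through sets strictly between A and C ends at a cover of A.
    cover : ∀ {A C} → Q A → Q C → A ⊂ C → ∃ λ B → HasseEdge Q B A
    cover {A} {C} qA = go (⊂-wellFounded C)
      where
      go : ∀ {C} → Acc (_⊂_ {n}) C → Q C → A ⊂ C → ∃ λ B → HasseEdge Q B A
      go {C} (acc rs) qC A⊂C with anySubset? (λ D → Q? D ×-dec (A ⊂? D ×-dec D ⊂? C))
      ... | yes (D , qD , A⊂D , D⊂C) = go (rs D⊂C) qD A⊂D
      ... | no ∄D = C , qC , qA , A⊂C , λ D qD (A⊂D , D⊂C) → ∄D (D , qD , A⊂D , D⊂C)

    source⇒maximal : ∀ {A} → Q A → Source A → Maximal A
    source⇒maximal qA srcA C qC A⊂C with cover qA qC A⊂C
    ... | B , e@(qB , _) = srcA B qB e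

    hasse-isNetwork⇔⊤ : (∀ x → Q ⁅ x ⁆) → IsNetwork Q (HasseEdge Q) ⇔ Q ⊤
    hasse-isNetwork⇔⊤ singleton = mk⇔ network⇒⊤ ⊤⇒network
      where
      network⇒⊤ : IsNetwork Q (HasseEdge Q) → Q ⊤
      network⇒⊤ (_ , A , qA , _ , unique) = subst Q A≡⊤ qA
        where
        x∈A : ∀ x → x ∈ A
        x∈A x with maximal-above (singleton x)
        ... | M , qM , x⊆M , maxM =
          subst (x ∈_) (unique M qM (maximal⇒source maxM)) (x⊆M (x∈⁅x⁆ x))

        A≡⊤ : A ≡ ⊤
        A≡⊤ = ⊆-antisym ⊆⊤ λ {x} _ → x∈A x

      ⊤⇒network : Q ⊤ → IsNetwork Q (HasseEdge Q)
      ⊤⇒network q⊤ = (λ A _ → hasse-acyclic A) , ⊤ , q⊤ , maximal⇒source ⊤-maximal ,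
        λ A qA srcA → ⊆∧⊄⇒≡ ⊆⊤ (source⇒maximal qA srcA ⊤ q⊤)

InC? : ∀ {n} k (R : Subset n → Subset n) → Decidable (InC k R)
InC? k R A = anySubset? λ U → (nonempty? U ×-dec ∣ U ∣ ≤? k) ×-dec ≡-dec _≟ᵇ_ (R U) A

singleton∈C : ∀ {n k R} → IsTransit n k R → 1 ≤ k → ∀ (x : Fin n) → InC k R ⁅ x ⁆
singleton∈C tr 1≤k x =
  ⁅ x ⁆ , ((x , x∈⁅x⁆ x) , subst (_≤ _) (sym (∣⁅x⁆∣≡1 x)) 1≤k) , IsTransit.singleton tr x

lemma2 : (n k : ℕ) → 1 ≤ n → 1 ≤ k → (R : Subset n → Subset n) → IsTransit n k R →
    IsNetwork (InC k R) (HasseEdge (InC k R)) ⇔ (∃ λ U → InXk k U × R U ≡ ⊤)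
lemma2 n k _ 1≤k R tr = hasse-isNetwork⇔⊤ (InC k R) (InC? k R) (singleton∈C tr 1≤k)
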